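{- Let $Q\in\mathcal C(\mathbb Q)$ be fixed. Then for all $P\in\mathcal C(\mathbb Q)$: (1) $\frac14 H(P)^2\le H(2P)\le 4H(P)^2$; (2) $\frac1c H(P)\le H(P+Q)\le cH(P)$ with $c=5H(Q)$.
   Context: Let $d$ be a squarefree integer with $d\neq 1$, and put $\Delta=d$ if $d\equiv 1\pmod 4$ and $\Delta=4d$ if $d\equiv 2,3\pmod 4$. Let $\mathcal C(\mathbb Q)=\{(x,y)\in\mathbb Q^2: x^2-\Delta y^2=4\}$, an abelian group with neutral element $(2,0)$ and addition $(r,s)+(t,u)=\big(\frac{rt+\Delta su}{2},\frac{ru+st}{2}\big)$; $2P=P+P$. For a rational number $x=r/s$ in lowest terms let $H(x)=\max\{|r|,|s|\}$, and for $P=(x,y)\in\mathcal C(\mathbb Q)$ let $H(P)=H(x)$. -}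

module Defs where

open import Data.Nat as ℕ using (ℕ)
open import Data.Integer as ℤ using (ℤ; +_; _%ℕ_; ∣_∣)
open import Data.Integer.Divisibility using (_∣_)
open import Data.Rational as ℚ using (ℚ; ↥_; ↧ₙ_; ½)
open import Data.Product using (_×_; _,_)
open import Relation.Binary.PropositionalEquality using (_≡_; _≢_)
open import Data.Bool using (if_then_else_)
open import Data.Nat using (_≡ᵇ_)

SquareFree : ℤ → Set
SquareFree d = (n : ℤ) → (n ℤ.* n) ∣ d → ∣ n ∣ ≡ 1

Δ : ℤ → ℤ
Δ d = if (d %ℕ 4) ≡ᵇ 1 then d else (+ 4) ℤ.* d

Pt : Set
Pt = ℚ × ℚ

OnCurve : ℤ → Pt → Set
OnCurve d (x , y) = (x ℚ.* x) ℚ.- (ℚ._/_ (Δ d) 1 ℚ.* (y ℚ.* y)) ≡ ℚ._/_ (+ 4) 1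

add : ℤ → Pt → Pt → Pt
add d (r , s) (t , u) =
  ( ½ ℚ.* ((r ℚ.* t) ℚ.+ (ℚ._/_ (Δ d) 1 ℚ.* (s ℚ.* u)))
  , ½ ℚ.* ((r ℚ.* u) ℚ.+ (s ℚ.* t)) )

double : ℤ → Pt → Pt
double d P = add d P P

Hℚ : ℚ → ℕ
Hℚ x = ℕ._⊔_ ∣ ↥ x ∣ (↧ₙ x)

H : Pt → ℕ
H (x , _) = Hℚ x

module Submission where

-- Write x(P) = a/b and x(Q) = p/q in lowest terms.  Doubling: on the curve x(2P) = x(P)² − 2 =
-- (a² − 2b²)/b², a fraction that is again in lowest terms, so H(2P) = max(|a² − 2b²|, b²), which
-- is within a factor 4 of H(P)² = max(a², b²).  Addition: x(P + Q) and x(P − Q) are the roots of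
-- X² − x(P) x(Q) X + (x(P)² + x(Q)² − 4).  Scaling by bq turns this into a monic integer
-- quadratic whose coefficients are bounded by H(P) H(Q) and 6 (H(P) H(Q))², so its rational
-- roots are integers of absolute value at most 3 H(P) H(Q), and H(P + Q) ≤ 3 H(P) H(Q).  The
-- relation is symmetric in x(P) and x(P + Q), which gives the reverse inequality.

open import Defs
open import Data.Integer using (ℤ; +_)
open import Relation.Binary.PropositionalEquality using (_≢_)

module ℚ-Ring where
  open import Data.Rational using (0ℚ)
  open import Data.Rational.Properties using (+-*-commutativeRing; _≟_)
  open import Relation.Nullary.Decidable using (dec⇒maybe)
  open import Tactic.RingSolver.Core.AlmostCommutativeRing
    using (AlmostCommutativeRing; fromCommutativeRing)
  open import Level using (0ℓ)

  -- The zero test lets Tactic.RingSolver drop monomials whose coefficients cancel.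
  ℚ-ring : AlmostCommutativeRing 0ℓ 0ℓ
  ℚ-ring = fromCommutativeRing +-*-commutativeRing (λ q → dec⇒maybe (0ℚ ≟ q))

module Embedding where
  open import Data.Nat as ℕ using (suc)
  import Data.Nat.Properties as ℕ
  open import Data.Nat.Coprimality using (1-coprimeTo) renaming (sym to coprime-sym)
  open import Data.Integer as ℤ using (∣_∣)
  import Data.Integer.Properties as ℤ
  open import Data.Rational using (ℚ; mkℚ; ↥_; ↧_; _/_; _+_; _*_; -_; _-_)
  open import Data.Rational.Properties using (↥p/↧p≡p; fromℚᵘ-cong; +-0-group)
  open import Data.Rational.Unnormalised using (mkℚᵘ; *≡*)
  open import Algebra.Properties.Group +-0-group using (inverseʳ-unique)
  open import Relation.Binary.PropositionalEquality

  -- Written i / 1 to agree definitionally with the constants Δ d / 1 and + 4 / 1 of OnCurve.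
  ι : ℤ → ℚ
  ι i = i / 1

  -- On this normal form ℚ's _+_ and _*_ compute: mkℚ i 0 _ + mkℚ j 0 _ reduces to
  -- ι (i * 1 + j * 1), and mkℚ i 0 _ * mkℚ j 0 _ to ι (i * j).
  ι≡mkℚ : ∀ i → ι i ≡ mkℚ i 0 (coprime-sym (1-coprimeTo ∣ i ∣))
  ι≡mkℚ i = ↥p/↧p≡p (mkℚ i 0 _)

  ι-injective : ∀ {i j} → ι i ≡ ι j → i ≡ j
  ι-injective {i} {j} eq = begin
    i          ≡⟨ cong ↥_ (ι≡mkℚ i) ⟨
    ↥ ι i      ≡⟨ cong ↥_ eq ⟩
    ↥ ι j      ≡⟨ cong ↥_ (ι≡mkℚ j) ⟩
    j          ∎
    where open ≡-Reasoning

  ι-homo-+ : ∀ i j → ι (i ℤ.+ j) ≡ ι i + ι j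
  ι-homo-+ i j = begin
    ι (i ℤ.+ j)                  ≡⟨ cong ι (cong₂ ℤ._+_ (ℤ.*-identityʳ i) (ℤ.*-identityʳ j)) ⟨
    ι (i ℤ.* + 1 ℤ.+ j ℤ.* + 1)  ≡⟨ cong₂ _+_ (ι≡mkℚ i) (ι≡mkℚ j) ⟨
    ι i + ι j                    ∎
    where open ≡-Reasoning

  ι-homo-* : ∀ i j → ι (i ℤ.* j) ≡ ι i * ι j
  ι-homo-* i j = sym (cong₂ _*_ (ι≡mkℚ i) (ι≡mkℚ j))

  ι-homo‿- : ∀ i → ι (ℤ.- i) ≡ - ι i
  ι-homo‿- i = inverseʳ-unique (ι i) (ι (ℤ.- i))
    (trans (sym (ι-homo-+ i (ℤ.- i))) (cong ι (ℤ.+-inverseʳ i)))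

  ι-homo-− : ∀ i j → ι (i ℤ.- j) ≡ ι i - ι j
  ι-homo-− i j = trans (ι-homo-+ i (ℤ.- j)) (cong (_+_ (ι i)) (ι-homo‿- j))

  p*ι↧p≡ι↥p : ∀ p → p * ι (↧ p) ≡ ι (↥ p)
  p*ι↧p≡ι↥p p@(mkℚ a d _) = trans (cong (p *_) (ι≡mkℚ (↧ p)))
    (fromℚᵘ-cong {mkℚᵘ (a ℤ.* ↧ p) (d ℕ.* 1)} {mkℚᵘ a 0}
      (*≡* (trans (ℤ.*-identityʳ (a ℤ.* ↧ p))
                  (cong (λ n → a ℤ.* + suc n) (sym (ℕ.*-identityʳ d))))))

module Fractions where
  open Embedding
  open import Data.Nat as ℕ using (ℕ; _⊔_; _≤_; NonZero)
  import Data.Nat.Properties as ℕ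
  open import Data.Nat.Divisibility using (_∣_; divides; ∣-refl)
  open import Data.Nat.Coprimality using (Coprime; coprime-divisor; recompute)
    renaming (sym to coprime-sym)
  open import Data.Integer as ℤ using (∣_∣)
  import Data.Integer.Properties as ℤ
  import Data.Integer.Divisibility.Signed as ℤ∣
  open import Data.Rational using (mkℚ; ↥_; ↧_; ↧ₙ_; _+_; _*_)
  open import Data.Rational.Properties using (*-1-commutativeMonoid; *-identityʳ)
  open import Algebra.Bundles using (CommutativeMonoid)
  open import Algebra.Properties.CommutativeSemigroup
    (CommutativeMonoid.commutativeSemigroup *-1-commutativeMonoid) using (xy∙z≈xz∙y)
  open import Data.List using (_∷_; [])
  open import Data.Product using (∃-syntax; _×_; _,_)
  open import Tactic.RingSolver using (solve)
  open ℚ-Ring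
  open import Relation.Binary.PropositionalEquality

  ↥-↧-coprime : ∀ p → Coprime ∣ ↥ p ∣ (↧ₙ p)
  ↥-↧-coprime (mkℚ _ _ c) = recompute c

  cross-multiply : ∀ {s m n} → s * ι n ≡ ι m → ↥ s ℤ.* n ≡ m ℤ.* ↧ s
  cross-multiply {s} {m} {n} eq = ι-injective (begin
    ι (↥ s ℤ.* n)        ≡⟨ ι-homo-* (↥ s) n ⟩
    ι (↥ s) * ι n        ≡⟨ cong (_* ι n) (p*ι↧p≡ι↥p s) ⟨
    s * ι (↧ s) * ι n    ≡⟨ xy∙z≈xz∙y s (ι (↧ s)) (ι n) ⟩
    s * ι n * ι (↧ s)    ≡⟨ cong (_* ι (↧ s)) eq ⟩
    ι m * ι (↧ s)        ≡⟨ ι-homo-* m (↧ s) ⟨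
    ι (m ℤ.* ↧ s)        ∎)
    where open ≡-Reasoning

  fraction⇒multiple-of-lowest-terms : ∀ {s m n} → s * ι (+ n) ≡ ι m →
                                      ∃[ k ] m ≡ ↥ s ℤ.* + k × n ≡ k ℕ.* ↧ₙ s
  fraction⇒multiple-of-lowest-terms {s} {m} {n} eq = k , m≡↥s*k , n≡k*↧s
    where
    open ≡-Reasoning
    ↥s*n≡m*↧s : ↥ s ℤ.* + n ≡ m ℤ.* ↧ s
    ↥s*n≡m*↧s = cross-multiply {s} {m} eq
    ↧s∣n : ↧ₙ s ∣ n
    ↧s∣n = coprime-divisor (coprime-sym (↥-↧-coprime s)) (divides ∣ m ∣ (begin
      ∣ ↥ s ∣ ℕ.* n      ≡⟨ ℤ.abs-* (↥ s) (+ n) ⟨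
      ∣ ↥ s ℤ.* + n ∣    ≡⟨ cong ∣_∣ ↥s*n≡m*↧s ⟩
      ∣ m ℤ.* ↧ s ∣      ≡⟨ ℤ.abs-* m (↧ s) ⟩
      ∣ m ∣ ℕ.* ↧ₙ s     ∎))
    k : ℕ
    k = _∣_.quotient ↧s∣n
    n≡k*↧s : n ≡ k ℕ.* ↧ₙ s
    n≡k*↧s = _∣_.equality ↧s∣n
    m≡↥s*k : m ≡ ↥ s ℤ.* + k
    m≡↥s*k = ℤ.*-cancelʳ-≡ m (↥ s ℤ.* + k) (↧ s) (begin
      m ℤ.* ↧ s              ≡⟨ ↥s*n≡m*↧s ⟨
      ↥ s ℤ.* + n            ≡⟨ cong (λ n → ↥ s ℤ.* + n) n≡k*↧s ⟩
      ↥ s ℤ.* + (k ℕ.* ↧ₙ s) ≡⟨ cong (↥ s ℤ.*_) (ℤ.pos-* k (↧ₙ s)) ⟩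
      ↥ s ℤ.* (+ k ℤ.* ↧ s)  ≡⟨ ℤ.*-assoc (↥ s) (+ k) (↧ s) ⟨
      ↥ s ℤ.* + k ℤ.* ↧ s    ∎)

  fraction⇒height≤ : ∀ {s m n} .{{_ : NonZero n}} → s * ι (+ n) ≡ ι m → Hℚ s ≤ ∣ m ∣ ⊔ n
  fraction⇒height≤ {s} {m} {n} eq = bound (fraction⇒multiple-of-lowest-terms {s} eq)
    where
    bound : ∃[ k ] m ≡ ↥ s ℤ.* + k × n ≡ k ℕ.* ↧ₙ s → Hℚ s ≤ ∣ m ∣ ⊔ n
    bound (k , m≡↥s*k , n≡k*↧s) = ℕ.⊔-mono-≤
      (subst (∣ ↥ s ∣ ≤_) (sym (trans (cong ∣_∣ m≡↥s*k) (ℤ.abs-* (↥ s) (+ k)))) (ℕ.m≤m*n ∣ ↥ s ∣ k))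
      (subst (↧ₙ s ≤_) (sym n≡k*↧s) (ℕ.m≤n*m (↧ₙ s) k))
      where
      k≢0 : k ≢ 0
      k≢0 refl = ℕ.≢-nonZero⁻¹ n n≡k*↧s
      instance
        k-nonZero : NonZero k
        k-nonZero = ℕ.≢-nonZero k≢0

  coprime-fraction⇒lowest-terms : ∀ {s m n} → s * ι (+ n) ≡ ι m → Coprime ∣ m ∣ n →
                                  ↥ s ≡ m × ↧ₙ s ≡ n
  coprime-fraction⇒lowest-terms {s} {m} {n} eq m⊥n =
    lowest (fraction⇒multiple-of-lowest-terms {s} eq)
    where
    lowest : ∃[ k ] m ≡ ↥ s ℤ.* + k × n ≡ k ℕ.* ↧ₙ s → ↥ s ≡ m × ↧ₙ s ≡ n
    lowest (k , m≡↥s*k , n≡k*↧s) =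
        sym (trans m≡↥s*k (trans (cong (λ k → ↥ s ℤ.* + k) k≡1) (ℤ.*-identityʳ (↥ s))))
      , sym (trans n≡k*↧s (trans (cong (ℕ._* ↧ₙ s) k≡1) (ℕ.*-identityˡ (↧ₙ s))))
      where
      k≡1 : k ≡ 1
      k≡1 = m⊥n ( divides ∣ ↥ s ∣ (trans (cong ∣_∣ m≡↥s*k) (ℤ.abs-* (↥ s) (+ k)))
                , divides (↧ₙ s) (trans n≡k*↧s (ℕ.*-comm k (↧ₙ s))) )

  ↧∣↥²⇒integral : ∀ z → ↧ₙ z ∣ ∣ ↥ z ∣ ℕ.* ∣ ↥ z ∣ → z ≡ ι (↥ z)
  ↧∣↥²⇒integral z ↧z∣↥z² = begin
    z                  ≡⟨ *-identityʳ z ⟨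
    z * ι (+ 1)        ≡⟨ cong (λ n → z * ι (+ n)) ↧z≡1 ⟨
    z * ι (↧ z)        ≡⟨ p*ι↧p≡ι↥p z ⟩
    ι (↥ z)            ∎
    where
    open ≡-Reasoning
    ↥z⊥↧z : Coprime ∣ ↥ z ∣ (↧ₙ z)
    ↥z⊥↧z = ↥-↧-coprime z
    ↧z≡1 : ↧ₙ z ≡ 1
    ↧z≡1 = ↥z⊥↧z (coprime-divisor (coprime-sym ↥z⊥↧z) ↧z∣↥z² , ∣-refl)

  monic-root-scaled : ∀ {z E C K U} → z * E ≡ C → z * z + K ≡ U * z →
                      C * C + K * (E * E) ≡ U * C * E
  monic-root-scaled {z} {E} {K = K} {U} refl eq = begin
    z * E * (z * E) + K * (E * E)  ≡⟨ solve (z ∷ E ∷ K ∷ []) ℚ-ring ⟩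
    (z * z + K) * (E * E)          ≡⟨ cong (_* (E * E)) eq ⟩
    U * z * (E * E)                ≡⟨ solve (z ∷ E ∷ U ∷ []) ℚ-ring ⟩
    U * (z * E) * E                ∎
    where open ≡-Reasoning

  monic-root⇒↧∣↥² : ∀ {z} k u → z * z + ι k ≡ ι u * z → ↧ₙ z ∣ ∣ ↥ z ∣ ℕ.* ∣ ↥ z ∣
  monic-root⇒↧∣↥² {z} k u eq = subst (↧ₙ z ∣_) (ℤ.abs-* c c) (ℤ∣.∣⇒∣ᵤ e∣c²)
    where
    c e : ℤ
    c = ↥ z
    e = ↧ z
    c²+ke²≡uce : c ℤ.* c ℤ.+ k ℤ.* (e ℤ.* e) ≡ u ℤ.* c ℤ.* e
    c²+ke²≡uce = ι-injective (begin
      ι (c ℤ.* c ℤ.+ k ℤ.* (e ℤ.* e))    ≡⟨ ι-homo-+ (c ℤ.* c) (k ℤ.* (e ℤ.* e)) ⟩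
      ι (c ℤ.* c) + ι (k ℤ.* (e ℤ.* e))  ≡⟨ cong₂ _+_ (ι-homo-* c c)
                                              (trans (ι-homo-* k (e ℤ.* e))
                                                     (cong (ι k *_) (ι-homo-* e e))) ⟩
      ι c * ι c + ι k * (ι e * ι e)      ≡⟨ monic-root-scaled {z} {U = ι u} (p*ι↧p≡ι↥p z) eq ⟩
      ι u * ι c * ι e                    ≡⟨ trans (ι-homo-* (u ℤ.* c) e)
                                                  (cong (_* ι e) (ι-homo-* u c)) ⟨
      ι (u ℤ.* c ℤ.* e)                  ∎)
      where open ≡-Reasoning
    e∣c² : e ℤ∣.∣ c ℤ.* c
    e∣c² = ℤ∣.∣m+n∣n⇒∣m (subst (e ℤ∣.∣_) (sym c²+ke²≡uce) (ℤ∣.∣n⇒∣m*n (u ℤ.* c) ℤ∣.∣-refl))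
                         (ℤ∣.∣n⇒∣m*n k (ℤ∣.∣n⇒∣m*n e ℤ∣.∣-refl))

  monic-root⇒integral-root : ∀ {z} k u → z * z + ι k ≡ ι u * z →
                             ∃[ c ] z ≡ ι c × c ℤ.* c ℤ.+ k ≡ u ℤ.* c
  monic-root⇒integral-root {z} k u eq = c , z≡c , ι-injective (begin
    ι (c ℤ.* c ℤ.+ k)    ≡⟨ trans (ι-homo-+ (c ℤ.* c) k) (cong (_+ ι k) (ι-homo-* c c)) ⟩
    ι c * ι c + ι k      ≡⟨ cong (λ w → w * w + ι k) z≡c ⟨
    z * z + ι k          ≡⟨ eq ⟩
    ι u * z              ≡⟨ cong (ι u *_) z≡c ⟩
    ι u * ι c            ≡⟨ ι-homo-* u c ⟨
    ι (u ℤ.* c)          ∎)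
    where
    open ≡-Reasoning
    c : ℤ
    c = ↥ z
    z≡c : z ≡ ι c
    z≡c = ↧∣↥²⇒integral z (monic-root⇒↧∣↥² k u eq)

module Curve where
  open Embedding
  open import Data.Rational using (ℚ; ½; _+_; _*_; _-_)
  open import Data.List using (_∷_; [])
  open import Tactic.RingSolver using (solve)
  open ℚ-Ring
  open import Relation.Binary.PropositionalEquality

  -- For x = x(P) and t = x(Q), the abscissae of P + Q and P − Q are the roots s of this relation.
  record Translate (t x s : ℚ) : Set where
    constructor translate
    field relation : s * s + (x * x + t * t - ι (+ 4)) ≡ x * t * s

  Translate-sym : ∀ {t x s} → Translate t x s → Translate t s x
  Translate-sym {t} {x} {s} (translate rel) = translate (begin
    x * x + (s * s + t * t - ι (+ 4))  ≡⟨ solve (t ∷ x ∷ s ∷ []) ℚ-ring ⟩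
    s * s + (x * x + t * t - ι (+ 4))  ≡⟨ rel ⟩
    x * t * s                          ≡⟨ solve (t ∷ x ∷ s ∷ []) ℚ-ring ⟩
    s * t * x                          ∎)
    where open ≡-Reasoning

  x²-Dy²≡c⇒Dy²≡x²-c : ∀ D x y {c} → x * x - D * (y * y) ≡ c → D * (y * y) ≡ x * x - c
  x²-Dy²≡c⇒Dy²≡x²-c D x y refl = solve (D ∷ x ∷ y ∷ []) ℚ-ring

  double-abscissa : ∀ D x y → D * (y * y) ≡ x * x - ι (+ 4) →
                    ½ * (x * x + D * (y * y)) ≡ x * x - ι (+ 2)
  double-abscissa D x y Dy² = begin
    ½ * (x * x + D * (y * y))        ≡⟨ cong (λ v → ½ * (x * x + v)) Dy² ⟩
    ½ * (x * x + (x * x - ι (+ 4)))  ≡⟨ solve (x ∷ []) ℚ-ring ⟩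
    x * x - ι (+ 2)                  ∎
    where open ≡-Reasoning

  ordinate-product² : ∀ D x y t u → D * (y * y) ≡ x * x - ι (+ 4) → D * (u * u) ≡ t * t - ι (+ 4) →
                      D * (y * u) * (D * (y * u)) ≡ (x * x - ι (+ 4)) * (t * t - ι (+ 4))
  ordinate-product² D x y t u Dy² Du² = begin
    D * (y * u) * (D * (y * u))            ≡⟨ solve (D ∷ y ∷ u ∷ []) ℚ-ring ⟩
    D * (y * y) * (D * (u * u))            ≡⟨ cong₂ _*_ Dy² Du² ⟩
    (x * x - ι (+ 4)) * (t * t - ι (+ 4))  ∎
    where open ≡-Reasoning

  sum-abscissa : ∀ x t w → w * w ≡ (x * x - ι (+ 4)) * (t * t - ι (+ 4)) →
                 Translate t x (½ * (x * t + w))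
  sum-abscissa x t w w² = translate (begin
    ½ * (x * t + w) * (½ * (x * t + w)) + (x * x + t * t - ι (+ 4))
      ≡⟨ solve (x ∷ t ∷ w ∷ []) ℚ-ring ⟩
    x * t * (½ * (x * t + w)) + ½ * ½ * (w * w - x * x * (t * t)) + (x * x + t * t - ι (+ 4))
      ≡⟨ cong (λ v → x * t * (½ * (x * t + w)) + ½ * ½ * (v - x * x * (t * t))
                     + (x * x + t * t - ι (+ 4))) w² ⟩
    x * t * (½ * (x * t + w)) + ½ * ½ * ((x * x - ι (+ 4)) * (t * t - ι (+ 4)) - x * x * (t * t))
      + (x * x + t * t - ι (+ 4))
      ≡⟨ solve (x ∷ t ∷ w ∷ []) ℚ-ring ⟩
    x * t * (½ * (x * t + w))  ∎)
    where open ≡-Reasoning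

  Translate-scaled : ∀ {t x s A P} B Q → Translate t x s → x * B ≡ A → t * Q ≡ P →
    s * (B * Q) * (s * (B * Q)) + (A * Q * (A * Q) + B * P * (B * P) - ι (+ 4) * (B * Q * (B * Q)))
      ≡ A * P * (s * (B * Q))
  Translate-scaled {t} {x} {s} B Q (translate rel) refl refl = begin
    s * (B * Q) * (s * (B * Q))
      + (x * B * Q * (x * B * Q) + B * (t * Q) * (B * (t * Q)) - ι (+ 4) * (B * Q * (B * Q)))
      ≡⟨ solve (t ∷ x ∷ s ∷ B ∷ Q ∷ []) ℚ-ring ⟩
    B * Q * (B * Q) * (s * s + (x * x + t * t - ι (+ 4)))
      ≡⟨ cong (B * Q * (B * Q) *_) rel ⟩
    B * Q * (B * Q) * (x * t * s)
      ≡⟨ solve (t ∷ x ∷ s ∷ B ∷ Q ∷ []) ℚ-ring ⟩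
    x * B * (t * Q) * (s * (B * Q))  ∎
    where open ≡-Reasoning

module Arithmetic where
  open import Data.Nat using (suc; _+_; _*_; _≤_; _<_; _⊔_; z<s)
  open import Data.Nat.Properties
  open import Data.Nat.Coprimality using (Coprime; coprime-divisor) renaming (sym to coprime-sym)
  open import Data.Nat.Divisibility using (_∣_; ∣-trans)
  open import Data.Integer as ℤ using (ℤ; +_; ∣_∣)
  import Data.Integer.Properties as ℤ
  import Data.Integer.Divisibility.Signed as ℤ∣
  import Data.Integer.Tactic.RingSolver as ℤ-Solver
  import Data.Nat.Tactic.RingSolver as ℕ-Solver
  open import Data.List using (_∷_; [])
  open import Data.Product using (_,_)
  open import Relation.Binary.PropositionalEquality

  coprime-*ʳ : ∀ {m n o} → Coprime m n → Coprime m o → Coprime m (n * o)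
  coprime-*ʳ {n = n} m⊥n m⊥o {d} (d∣m , d∣no) = m⊥o (d∣m , coprime-divisor d⊥n d∣no)
    where
    d⊥n : Coprime d n
    d⊥n (e∣d , e∣n) = m⊥n (∣-trans e∣d d∣m , e∣n)

  coprime-squares : ∀ {m n} → Coprime m n → Coprime (m * m) (n * n)
  coprime-squares {m} {n} m⊥n = coprime-sym (coprime-*ʳ (coprime-sym m⊥n²) (coprime-sym m⊥n²))
    where
    m⊥n² : Coprime m (n * n)
    m⊥n² = coprime-*ʳ m⊥n m⊥n

  ∣i*j∣≤m*n : ∀ i j {m n} → ∣ i ∣ ≤ m → ∣ j ∣ ≤ n → ∣ i ℤ.* j ∣ ≤ m * n
  ∣i*j∣≤m*n i j i≤m j≤n = subst (_≤ _) (sym (ℤ.abs-* i j)) (*-mono-≤ i≤m j≤n)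

  i-j+j≡i : ∀ i j → i ℤ.- j ℤ.+ j ≡ i
  i-j+j≡i = ℤ-Solver.solve-∀

  i+j-j≡i : ∀ i j → i ℤ.+ j ℤ.- j ≡ i
  i+j-j≡i = ℤ-Solver.solve-∀

  ∣i∣≤∣i-j∣+∣j∣ : ∀ i j → ∣ i ∣ ≤ ∣ i ℤ.- j ∣ + ∣ j ∣
  ∣i∣≤∣i-j∣+∣j∣ i j = subst (_≤ ∣ i ℤ.- j ∣ + ∣ j ∣) (cong ∣_∣ (i-j+j≡i i j))
                            (ℤ.∣i+j∣≤∣i∣+∣j∣ (i ℤ.- j) j)

  coprime⇒a²-2b²⊥b² : ∀ a b → Coprime ∣ a ∣ b →
                      Coprime ∣ a ℤ.* a ℤ.- + 2 ℤ.* (+ b ℤ.* + b) ∣ (b * b)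
  coprime⇒a²-2b²⊥b² a b a⊥b {d} (d∣a²-2b² , d∣b²) = coprime-squares a⊥b (d∣∣a∣² , d∣b²)
    where
    d∣2b² : + d ℤ∣.∣ + 2 ℤ.* (+ b ℤ.* + b)
    d∣2b² = ℤ∣.∣n⇒∣m*n (+ 2) (ℤ∣.∣ᵤ⇒∣ (subst (d ∣_) (sym (ℤ.abs-* (+ b) (+ b))) d∣b²))
    d∣a² : + d ℤ∣.∣ a ℤ.* a
    d∣a² = subst (+ d ℤ∣.∣_) (i-j+j≡i (a ℤ.* a) (+ 2 ℤ.* (+ b ℤ.* + b)))
      (ℤ∣.∣m∣n⇒∣m+n {m = a ℤ.* a ℤ.- + 2 ℤ.* (+ b ℤ.* + b)} (ℤ∣.∣ᵤ⇒∣ d∣a²-2b²) d∣2b²)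
    d∣∣a∣² : d ∣ ∣ a ∣ * ∣ a ∣
    d∣∣a∣² = subst (d ∣_) (ℤ.abs-* a a) (ℤ∣.∣⇒∣ᵤ d∣a²)

  m≤n+2o⇒m⊔o≤4[n⊔o] : ∀ {m n o} → m ≤ n + 2 * o → m ⊔ o ≤ 4 * (n ⊔ o)
  m≤n+2o⇒m⊔o≤4[n⊔o] {m} {n} {o} m≤n+2o = ⊔-lub (begin
    m            ≤⟨ m≤n+2o ⟩
    n + 2 * o    ≤⟨ +-mono-≤ (m≤m⊔n n o) (*-monoʳ-≤ 2 (m≤n⊔m n o)) ⟩
    3 * (n ⊔ o)  ≤⟨ *-monoˡ-≤ (n ⊔ o) (n≤1+n 3) ⟩
    4 * (n ⊔ o)  ∎)
    (≤-trans (m≤n⊔m n o) (m≤n*m (n ⊔ o) 4))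
    where open ≤-Reasoning

  3M<n⇒Mn+6M²<n² : ∀ M n → 3 * M < n → M * n + 6 * (M * M) < n * n
  3M<n⇒Mn+6M²<n² M n 3M<n with m≤n⇒∃[o]m+o≡n 3M<n
  ... | r , refl = subst (M * n + 6 * (M * M) <_) (expand M r) (m<m+n (M * n + 6 * (M * M)) z<s)
    where
    expand : ∀ M r → M * (suc (3 * M) + r) + 6 * (M * M) + suc (5 * M + 5 * M * r + 2 * r + r * r)
                     ≡ (suc (3 * M) + r) * (suc (3 * M) + r)
    expand = ℕ-Solver.solve-∀

  n²≤Mn+6M²⇒n≤3M : ∀ n M → n * n ≤ M * n + 6 * (M * M) → n ≤ 3 * M
  n²≤Mn+6M²⇒n≤3M n M n²≤ = ≮⇒≥ λ 3M<n → <⇒≱ (3M<n⇒Mn+6M²<n² M n 3M<n) n²≤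

  ∣α²+β²-4γ²∣≤6M² : ∀ α β γ {M} → ∣ α ∣ ≤ M → ∣ β ∣ ≤ M → ∣ γ ∣ ≤ M →
                    ∣ α ℤ.* α ℤ.+ β ℤ.* β ℤ.- + 4 ℤ.* (γ ℤ.* γ) ∣ ≤ 6 * (M * M)
  ∣α²+β²-4γ²∣≤6M² α β γ {M} α≤M β≤M γ≤M = begin
    ∣ α ℤ.* α ℤ.+ β ℤ.* β ℤ.- + 4 ℤ.* (γ ℤ.* γ) ∣
      ≤⟨ ℤ.∣i-j∣≤∣i∣+∣j∣ (α ℤ.* α ℤ.+ β ℤ.* β) (+ 4 ℤ.* (γ ℤ.* γ)) ⟩
    ∣ α ℤ.* α ℤ.+ β ℤ.* β ∣ + ∣ + 4 ℤ.* (γ ℤ.* γ) ∣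
      ≤⟨ +-monoˡ-≤ ∣ + 4 ℤ.* (γ ℤ.* γ) ∣ (ℤ.∣i+j∣≤∣i∣+∣j∣ (α ℤ.* α) (β ℤ.* β)) ⟩
    ∣ α ℤ.* α ∣ + ∣ β ℤ.* β ∣ + ∣ + 4 ℤ.* (γ ℤ.* γ) ∣
      ≤⟨ +-mono-≤ (+-mono-≤ (∣i*j∣≤m*n α α α≤M α≤M) (∣i*j∣≤m*n β β β≤M β≤M))
                  (∣i*j∣≤m*n (+ 4) (γ ℤ.* γ) ≤-refl (∣i*j∣≤m*n γ γ γ≤M γ≤M)) ⟩
    M * M + M * M + 4 * (M * M)
      ≡⟨ ℕ-Solver.solve (M ∷ []) ⟩
    6 * (M * M)  ∎
    where open ≤-Reasoning

  quadratic-root-bound : ∀ c k u {M} → c ℤ.* c ℤ.+ k ≡ u ℤ.* c → ∣ u ∣ ≤ M → ∣ k ∣ ≤ 6 * (M * M) →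
                         ∣ c ∣ ≤ 3 * M
  quadratic-root-bound c k u {M} eq u≤M k≤6M² = n²≤Mn+6M²⇒n≤3M ∣ c ∣ M (begin
    ∣ c ∣ * ∣ c ∣            ≡⟨ ℤ.abs-* c c ⟨
    ∣ c ℤ.* c ∣              ≡⟨ cong ∣_∣ c²≡uc-k ⟩
    ∣ u ℤ.* c ℤ.- k ∣        ≤⟨ ℤ.∣i-j∣≤∣i∣+∣j∣ (u ℤ.* c) k ⟩
    ∣ u ℤ.* c ∣ + ∣ k ∣      ≤⟨ +-mono-≤ (∣i*j∣≤m*n u c u≤M ≤-refl) k≤6M² ⟩
    M * ∣ c ∣ + 6 * (M * M)  ∎)
    where
    open ≤-Reasoning
    c²≡uc-k : c ℤ.* c ≡ u ℤ.* c ℤ.- k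
    c²≡uc-k = trans (sym (i+j-j≡i (c ℤ.* c) k)) (cong (ℤ._- k) eq)

module Heights where
  open Embedding
  open Fractions
  open Curve
  open Arithmetic
  open import Data.Nat as ℕ using (ℕ; _⊔_; _≤_)
  import Data.Nat.Properties as ℕ
  open import Data.Integer as ℤ using (ℤ; +_; ∣_∣)
  import Data.Integer.Properties as ℤ
  open import Data.Rational using (ℚ; ↥_; ↧_; ↧ₙ_; _+_; _*_; _-_)
  open import Data.List using (_∷_; [])
  open import Data.Product using (∃-syntax; _×_; _,_)
  open import Tactic.RingSolver using (solve)
  open ℚ-Ring
  open import Relation.Binary.PropositionalEquality

  ∣↥p∣≤Hp : ∀ p → ∣ ↥ p ∣ ≤ Hℚ p
  ∣↥p∣≤Hp p = ℕ.m≤m⊔n ∣ ↥ p ∣ (↧ₙ p)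

  ↧p≤Hp : ∀ p → ↧ₙ p ≤ Hℚ p
  ↧p≤Hp p = ℕ.m≤n⊔m ∣ ↥ p ∣ (↧ₙ p)

  x²-2-lowest-terms : ∀ x {D} → D ≡ x * x - ι (+ 2) →
    ↥ D ≡ ↥ x ℤ.* ↥ x ℤ.- + 2 ℤ.* (↧ x ℤ.* ↧ x) × ↧ₙ D ≡ ↧ₙ x ℕ.* ↧ₙ x
  x²-2-lowest-terms x {D} D≡x²-2 = coprime-fraction⇒lowest-terms {D} D*b²≡a²-2b²
    (coprime⇒a²-2b²⊥b² (↥ x) (↧ₙ x) (↥-↧-coprime x))
    where
    a b : ℤ
    a = ↥ x
    b = ↧ x
    rearrange : ∀ x B → (x * x - ι (+ 2)) * (B * B) ≡ x * B * (x * B) - ι (+ 2) * (B * B)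
    rearrange x B = solve (x ∷ B ∷ []) ℚ-ring
    D*b²≡a²-2b² : D * ι (b ℤ.* b) ≡ ι (a ℤ.* a ℤ.- + 2 ℤ.* (b ℤ.* b))
    D*b²≡a²-2b² = begin
      D * ι (b ℤ.* b)                              ≡⟨ cong₂ _*_ D≡x²-2 (ι-homo-* b b) ⟩
      (x * x - ι (+ 2)) * (ι b * ι b)              ≡⟨ rearrange x (ι b) ⟩
      x * ι b * (x * ι b) - ι (+ 2) * (ι b * ι b)  ≡⟨ cong (λ A → A * A - ι (+ 2) * (ι b * ι b))
                                                          (p*ι↧p≡ι↥p x) ⟩
      ι a * ι a - ι (+ 2) * (ι b * ι b)            ≡⟨ cong₂ _-_ (ι-homo-* a a)
                                                       (trans (ι-homo-* (+ 2) (b ℤ.* b))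
                                                              (cong (ι (+ 2) *_) (ι-homo-* b b))) ⟨
      ι (a ℤ.* a) - ι (+ 2 ℤ.* (b ℤ.* b))          ≡⟨ ι-homo-− (a ℤ.* a) (+ 2 ℤ.* (b ℤ.* b)) ⟨
      ι (a ℤ.* a ℤ.- + 2 ℤ.* (b ℤ.* b))            ∎
      where open ≡-Reasoning

  double-height : ∀ x {D} → D ≡ x * x - ι (+ 2) →
                  Hℚ x ℕ.* Hℚ x ≤ 4 ℕ.* Hℚ D × Hℚ D ≤ 4 ℕ.* (Hℚ x ℕ.* Hℚ x)
  double-height x {D} D≡x²-2 =
      subst₂ (λ h h′ → h ≤ 4 ℕ.* h′) (sym Hx²≡A⊔B) (sym HD≡M⊔B) (m≤n+2o⇒m⊔o≤4[n⊔o] A≤M+2B)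
    , subst₂ (λ h h′ → h ≤ 4 ℕ.* h′) (sym HD≡M⊔B) (sym Hx²≡A⊔B) (m≤n+2o⇒m⊔o≤4[n⊔o] M≤A+2B)
    where
    a b : ℤ
    a = ↥ x
    b = ↧ x
    A B M : ℕ
    A = ∣ a ℤ.* a ∣
    B = ↧ₙ x ℕ.* ↧ₙ x
    M = ∣ a ℤ.* a ℤ.- + 2 ℤ.* (b ℤ.* b) ∣
    Hx²≡A⊔B : Hℚ x ℕ.* Hℚ x ≡ A ⊔ B
    Hx²≡A⊔B = trans (ℕ.mono-≤-distrib-⊔ (λ h → ℕ.*-mono-≤ h h) ∣ a ∣ (↧ₙ x))
                    (cong (_⊔ B) (sym (ℤ.abs-* a a)))
    HD≡M⊔B : Hℚ D ≡ M ⊔ B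
    HD≡M⊔B = let ↥D≡m , ↧D≡B = x²-2-lowest-terms x D≡x²-2 in cong₂ _⊔_ (cong ∣_∣ ↥D≡m) ↧D≡B
    M≤A+2B : M ≤ A ℕ.+ 2 ℕ.* B
    M≤A+2B = ℤ.∣i-j∣≤∣i∣+∣j∣ (a ℤ.* a) (+ 2 ℤ.* (b ℤ.* b))
    A≤M+2B : A ≤ M ℕ.+ 2 ℕ.* B
    A≤M+2B = ∣i∣≤∣i-j∣+∣j∣ (a ℤ.* a) (+ 2 ℤ.* (b ℤ.* b))

  -- (aq)² + (bp)² − 4(bq)² for x = a/b and t = p/q: the constant term of the relation
  -- Translate t x X after the substitution X = Z / (bq), which makes it monic in Z.
  constant-term : ℚ → ℚ → ℤ
  constant-term x t = α ℤ.* α ℤ.+ β ℤ.* β ℤ.- + 4 ℤ.* (γ ℤ.* γ)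
    where
    α β γ : ℤ
    α = ↥ x ℤ.* ↧ t
    β = ↧ x ℤ.* ↥ t
    γ = ↧ x ℤ.* ↧ t

  ι-constant-term : ∀ x t → ι (constant-term x t) ≡
    ι (↥ x) * ι (↧ t) * (ι (↥ x) * ι (↧ t)) + ι (↧ x) * ι (↥ t) * (ι (↧ x) * ι (↥ t))
      - ι (+ 4) * (ι (↧ x) * ι (↧ t) * (ι (↧ x) * ι (↧ t)))
  ι-constant-term x t = trans (ι-homo-− (α ℤ.* α ℤ.+ β ℤ.* β) (+ 4 ℤ.* (γ ℤ.* γ)))
    (cong₂ _-_ (trans (ι-homo-+ (α ℤ.* α) (β ℤ.* β))
                      (cong₂ _+_ (ι-square (↥ x) (↧ t)) (ι-square (↧ x) (↥ t))))
               (trans (ι-homo-* (+ 4) (γ ℤ.* γ))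
                      (cong (ι (+ 4) *_) (ι-square (↧ x) (↧ t)))))
    where
    α β γ : ℤ
    α = ↥ x ℤ.* ↧ t
    β = ↧ x ℤ.* ↥ t
    γ = ↧ x ℤ.* ↧ t
    ι-square : ∀ i j → ι (i ℤ.* j ℤ.* (i ℤ.* j)) ≡ ι i * ι j * (ι i * ι j)
    ι-square i j = trans (ι-homo-* (i ℤ.* j) (i ℤ.* j)) (cong₂ _*_ (ι-homo-* i j) (ι-homo-* i j))

  Translate⇒scaled-monic-root : ∀ {t x s} → Translate t x s →
    s * ι (↧ x ℤ.* ↧ t) * (s * ι (↧ x ℤ.* ↧ t)) + ι (constant-term x t)
      ≡ ι (↥ x ℤ.* ↥ t) * (s * ι (↧ x ℤ.* ↧ t))
  Translate⇒scaled-monic-root {t} {x} {s} rel = begin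
    z * z + ι (constant-term x t)
      ≡⟨ cong₂ (λ w k → w * w + k) z≡ (ι-constant-term x t) ⟩
    s * (B * Q) * (s * (B * Q)) + (A * Q * (A * Q) + B * P * (B * P) - ι (+ 4) * (B * Q * (B * Q)))
      ≡⟨ Translate-scaled B Q rel (p*ι↧p≡ι↥p x) (p*ι↧p≡ι↥p t) ⟩
    A * P * (s * (B * Q))
      ≡⟨ cong₂ _*_ (ι-homo-* (↥ x) (↥ t)) z≡ ⟨
    ι (↥ x ℤ.* ↥ t) * z  ∎
    where
    open ≡-Reasoning
    A B P Q z : ℚ
    A = ι (↥ x)
    B = ι (↧ x)
    P = ι (↥ t)
    Q = ι (↧ t)
    z = s * ι (↧ x ℤ.* ↧ t)
    z≡ : z ≡ s * (B * Q)
    z≡ = cong (s *_) (ι-homo-* (↧ x) (↧ t))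

  translate-height : ∀ {t x s} → Translate t x s → Hℚ s ≤ 3 ℕ.* (Hℚ x ℕ.* Hℚ t)
  translate-height {t} {x} {s} rel =
    bound (monic-root⇒integral-root (constant-term x t) (↥ x ℤ.* ↥ t)
                                    (Translate⇒scaled-monic-root rel))
    where
    M : ℕ
    M = Hℚ x ℕ.* Hℚ t
    bound : ∃[ c ] s * ι (↧ x ℤ.* ↧ t) ≡ ι c × c ℤ.* c ℤ.+ constant-term x t ≡ ↥ x ℤ.* ↥ t ℤ.* c →
            Hℚ s ≤ 3 ℕ.* M
    bound (c , s*bq≡c , c-root) = ℕ.≤-trans (fraction⇒height≤ {s} {c} {↧ₙ x ℕ.* ↧ₙ t} s*bq≡c)
      (ℕ.⊔-lub
        (quadratic-root-bound c (constant-term x t) (↥ x ℤ.* ↥ t) c-root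
          (∣i*j∣≤m*n (↥ x) (↥ t) (∣↥p∣≤Hp x) (∣↥p∣≤Hp t))
          (∣α²+β²-4γ²∣≤6M² (↥ x ℤ.* ↧ t) (↧ x ℤ.* ↥ t) (↧ x ℤ.* ↧ t)
            (∣i*j∣≤m*n (↥ x) (↧ t) (∣↥p∣≤Hp x) (↧p≤Hp t))
            (∣i*j∣≤m*n (↧ x) (↥ t) (↧p≤Hp x) (∣↥p∣≤Hp t))
            (∣i*j∣≤m*n (↧ x) (↧ t) (↧p≤Hp x) (↧p≤Hp t))))
        (ℕ.≤-trans (ℕ.*-mono-≤ (↧p≤Hp x) (↧p≤Hp t)) (ℕ.m≤n*m M 3)))

open Embedding using (ι)
open Curve
  using (Translate; Translate-sym; x²-Dy²≡c⇒Dy²≡x²-c; double-abscissa; ordinate-product²; sum-abscissa)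
open Heights using (double-height; translate-height)
open import Data.Nat using (_*_; _≤_)
open import Data.Nat.Properties using (≤-trans; *-monoˡ-≤; m≤n+m; module ≤-Reasoning)
import Data.Nat.Tactic.RingSolver as ℕ-Solver
open import Data.List using (_∷_; [])
open import Data.Product using (_×_; _,_; proj₁)
open import Data.Rational as ℚ using (ℚ)
open import Relation.Binary.PropositionalEquality using (_≡_)

3mn≤5nm : ∀ m n → 3 * (m * n) ≤ 5 * n * m
3mn≤5nm m n = begin
  3 * (m * n)  ≤⟨ *-monoˡ-≤ (m * n) (m≤n+m 3 2) ⟩
  5 * (m * n)  ≡⟨ ℕ-Solver.solve (m ∷ n ∷ []) ⟩
  5 * n * m    ∎
  where open ≤-Reasoning

proposition4p5 : (d : ℤ) → SquareFree d → d ≢ + 1 →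
    (Q : Pt) → OnCurve d Q →
    (P : Pt) → OnCurve d P →
      ((H P * H P ≤ 4 * H (double d P)) × (H (double d P) ≤ 4 * (H P * H P)))
      × ((H P ≤ (5 * H Q) * H (add d P Q)) × (H (add d P Q) ≤ (5 * H Q) * H P))
proposition4p5 d _ _ (t , u) Q∈𝒞 (x , y) P∈𝒞 =
    double-height x x[2P]
  , ( ≤-trans (translate-height (Translate-sym P+Q)) (3mn≤5nm (Hℚ s) (Hℚ t))
    , ≤-trans (translate-height P+Q) (3mn≤5nm (Hℚ x) (Hℚ t)) )
  where
  D s : ℚ
  D = ι (Δ d)
  s = proj₁ (add d (x , y) (t , u))
  Dy² : D ℚ.* (y ℚ.* y) ≡ x ℚ.* x ℚ.- ι (+ 4)
  Dy² = x²-Dy²≡c⇒Dy²≡x²-c D x y P∈𝒞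
  Du² : D ℚ.* (u ℚ.* u) ≡ t ℚ.* t ℚ.- ι (+ 4)
  Du² = x²-Dy²≡c⇒Dy²≡x²-c D t u Q∈𝒞
  x[2P] : proj₁ (double d (x , y)) ≡ x ℚ.* x ℚ.- ι (+ 2)
  x[2P] = double-abscissa D x y Dy²
  P+Q : Translate t x s
  P+Q = sum-abscissa x t (D ℚ.* (y ℚ.* u)) (ordinate-product² D x y t u Dy² Du²)
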